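{- In the Bergman Game, from any initial state $S$ with $|S|$ chips, every play following the Quick Termination strategy terminates after at most $4|S|$ moves.
   Context: The Bergman Game: a state is a function $a:\mathbb{Z}\to\mathbb{Z}_{\geq 0}$ with finite support; $a_i$ is the number of chips (summands) at index $i$, and $|S|=\sum_i a_i$. A combine at index $i$ is available if $a_i \geq 1$ and $a_{i+1} \geq 1$; it decreases $a_i$ and $a_{i+1}$ by $1$ each and increases $a_{i+2}$ by $1$. A split at index $i$ is available if $a_i \geq 2$; it decreases $a_i$ by $2$ and increases each of $a_{i+1}$ and $a_{i-2}$ by $1$. The game continues until no move is available. The Quick Termination strategy: at each turn, choose a move from the first available category in the following priority list (any choice within a category is allowed): (1) any combine; (2) a split at an index $i$ with $a_i \geq 3$; (3) a split at an index $i$ with $a_i = 2$, $a_{i-1} = a_{i+1} = 0$, and $a_{i-3} > 0$ or $a_{i+2} > 0$; (4) a split at an index $i$ with $a_i = 2$, $a_{i-1} = a_{i+1} = a_{i+2} = 0$, and $a_{i-2} \geq 2$; (5) a split at the largest (rightmost) index at which a split is available. -}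

module Defs where

open import Data.Nat as ℕ using (ℕ; zero; suc)
open import Data.Integer as ℤ using (ℤ; +_)
open import Data.Product using (Σ; ∃; _×_; _,_)
open import Data.Sum using (_⊎_)
open import Relation.Binary.PropositionalEquality using (_≡_; _≢_)
open import Relation.Nullary using (¬_)

record State : Set where
  field
    chips   : ℤ → ℕ
    bound   : ℕ
    support : ∀ i → ℕ._<_ bound ℤ.∣ i ∣ → chips i ≡ 0
open State public

sumFrom : (ℤ → ℕ) → ℕ → ℕ → ℕ
sumFrom f N zero    = 0
sumFrom f N (suc k) = sumFrom f N k ℕ.+ f (+ k ℤ.- + N)

-- |S| = Σ_i a_i, computed over the window [-N, N] containing the support
size : State → ℕ
size S = sumFrom (chips S) (bound S) (suc (2 ℕ.* bound S))

CombineStep : (a : ℤ → ℕ) → ℤ → (b : ℤ → ℕ) → Set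
CombineStep a i b =
  (a i ≡ suc (b i)) ×
  (a (i ℤ.+ + 1) ≡ suc (b (i ℤ.+ + 1))) ×
  (b (i ℤ.+ + 2) ≡ suc (a (i ℤ.+ + 2))) ×
  (∀ j → j ≢ i → j ≢ i ℤ.+ + 1 → j ≢ i ℤ.+ + 2 → b j ≡ a j)

SplitStep : (a : ℤ → ℕ) → ℤ → (b : ℤ → ℕ) → Set
SplitStep a i b =
  (a i ≡ suc (suc (b i))) ×
  (b (i ℤ.+ + 1) ≡ suc (a (i ℤ.+ + 1))) ×
  (b (i ℤ.- + 2) ≡ suc (a (i ℤ.- + 2))) ×
  (∀ j → j ≢ i → j ≢ i ℤ.+ + 1 → j ≢ i ℤ.- + 2 → b j ≡ a j)

Cat1 : (ℤ → ℕ) → ℤ → Set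
Cat1 a i = (1 ℕ.≤ a i) × (1 ℕ.≤ a (i ℤ.+ + 1))

Cat2 : (ℤ → ℕ) → ℤ → Set
Cat2 a i = 3 ℕ.≤ a i

Cat3 : (ℤ → ℕ) → ℤ → Set
Cat3 a i = (a i ≡ 2) × (a (i ℤ.- + 1) ≡ 0) × (a (i ℤ.+ + 1) ≡ 0) ×
           ((0 ℕ.< a (i ℤ.- + 3)) ⊎ (0 ℕ.< a (i ℤ.+ + 2)))

Cat4 : (ℤ → ℕ) → ℤ → Set
Cat4 a i = (a i ≡ 2) × (a (i ℤ.- + 1) ≡ 0) × (a (i ℤ.+ + 1) ≡ 0) ×
           (a (i ℤ.+ + 2) ≡ 0) × (2 ℕ.≤ a (i ℤ.- + 2))

Cat5 : (ℤ → ℕ) → ℤ → Set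
Cat5 a i = (2 ℕ.≤ a i) × (∀ j → i ℤ.< j → a j ℕ.< 2)

NoneOf : ((ℤ → ℕ) → ℤ → Set) → (ℤ → ℕ) → Set
NoneOf C a = ∀ j → ¬ C a j

data QTStep (a : ℤ → ℕ) (b : ℤ → ℕ) : Set where
  qt1 : ∀ i → Cat1 a i → CombineStep a i b → QTStep a b
  qt2 : ∀ i → NoneOf Cat1 a →
        Cat2 a i → SplitStep a i b → QTStep a b
  qt3 : ∀ i → NoneOf Cat1 a → NoneOf Cat2 a →
        Cat3 a i → SplitStep a i b → QTStep a b
  qt4 : ∀ i → NoneOf Cat1 a → NoneOf Cat2 a → NoneOf Cat3 a →
        Cat4 a i → SplitStep a i b → QTStep a b
  qt5 : ∀ i → NoneOf Cat1 a → NoneOf Cat2 a → NoneOf Cat3 a → NoneOf Cat4 a →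
        Cat5 a i → SplitStep a i b → QTStep a b

data QTPlay : (ℤ → ℕ) → ℕ → Set where
  done : ∀ {a} → QTPlay a 0
  step : ∀ {a b n} → QTStep a b → QTPlay b n → QTPlay a (suc n)

-- Call an index j a cluster of a state a if a j ≥ 2, or a j ≥ 1 and a (j + 1) ≥ 1, and let
-- ℓ(a) count the singletons (a j = 1, a (j + 1) = 0) to the right of every cluster; ℓ ≤ |S|.
-- Along a Quick Termination play 4|S| − ℓ drops by at least one per move: a combine loses a
-- chip and raises ℓ by at most 2; a split of category 2 or 3 keeps |S|, does not lower ℓ, and
-- forces a combine next; category 4 is never the first available category, since it yields
-- category 3 two places to the left; and a category-5 split turns the rightmost cluster into
-- one more singleton. Hence n ≤ 4|S| − ℓ(S). The scan computing ℓ runs over one fixed finite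
-- window, wide enough that no chip leaves it during the n moves (a move shifts chips by at
-- most two places).

module Submission where

open import Defs
open import Data.Nat using (ℕ; zero; suc; _+_; _*_; _∸_; _≤_; _<_; _≤′_; ≤′-refl; ≤′-step; z≤n; s≤s; s≤s⁻¹; _≟_)
open import Data.Nat.Properties
import Data.Nat.Tactic.RingSolver as ℕSolver
open import Data.Integer as ℤ using (ℤ; +_; -[1+_]; +<+)
import Data.Integer.Properties as ℤP
open import Data.Integer.Tactic.RingSolver using (solve-∀)
open import Algebra.Properties.CommutativeSemigroup +-commutativeSemigroup using (interchange)
open import Algebra.Properties.AbelianGroup ℤP.+-0-abelianGroup using (∙-cancelˡ; ∙-cancelʳ)
open import Data.Product using (∃; ∃-syntax; _×_; _,_; proj₁; proj₂)
open import Data.Sum using (inj₁; inj₂)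
open import Data.Empty using (⊥-elim)
open import Function using (_∘_)
open import Relation.Nullary using (¬_; yes; no; contradiction)
open import Relation.Binary.PropositionalEquality

-- Scanning configurations indexed by ℕ

private variable
  c p r r′ L : ℕ
  g h u v : ℕ → ℕ

-- loose g L is ℓ computed on the indices below L: scan resets the count at a cluster and
-- increments it at a singleton.
scan : ℕ → ℕ → ℕ → ℕ
scan 0             _       r = r
scan 1             0       r = suc r
scan 1             (suc _) r = 0
scan (suc (suc _)) _       r = 0

loose : (ℕ → ℕ) → ℕ → ℕ
loose g zero    = 0
loose g (suc j) = scan (g j) (g (suc j)) (loose g j)

sumTo : (ℕ → ℕ) → ℕ → ℕ
sumTo g zero    = 0
sumTo g (suc j) = sumTo g j + g j

scan-≤-suc : ∀ x y r → scan x y r ≤ suc r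
scan-≤-suc 0             _       r = n≤1+n r
scan-≤-suc 1             0       r = ≤-refl
scan-≤-suc 1             (suc _) r = z≤n
scan-≤-suc (suc (suc _)) _       r = z≤n

scan-≤-+ : ∀ x y r → scan x y r ≤ r + x
scan-≤-+ 0             _       r = m≤m+n r 0
scan-≤-+ 1             0       r = ≤-reflexive (+-comm 1 r)
scan-≤-+ 1             (suc _) r = z≤n
scan-≤-+ (suc (suc _)) _       r = z≤n

scan-mono : ∀ x y → r ≤ r′ + c → scan x y r ≤ scan x y r′ + c
scan-mono 0             _       le = le
scan-mono 1             0       le = s≤s le
scan-mono 1             (suc _) le = z≤n
scan-mono (suc (suc _)) _       le = z≤n

scan-pair : ∀ x y r → scan (suc x) (suc y) r ≡ 0
scan-pair 0       _ _ = refl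
scan-pair (suc _) _ _ = refl

scan-sparse : ∀ x y r → x < 2 → ¬ (1 ≤ x × 1 ≤ y) → scan x y r ≡ x + r
scan-sparse 0 _       _ _ _    = refl
scan-sparse 1 0       _ _ _    = refl
scan-sparse 1 (suc _) _ _ pair = contradiction (s≤s z≤n , s≤s z≤n) pair
scan-sparse (suc (suc _)) _ _ (s≤s (s≤s ())) _

loose≤sumTo : ∀ g L → loose g L ≤ sumTo g L
loose≤sumTo g zero    = z≤n
loose≤sumTo g (suc L) = ≤-trans (scan-≤-+ (g L) (g (suc L)) (loose g L)) (+-monoˡ-≤ (g L) (loose≤sumTo g L))

EqualFrom : ℕ → (ℕ → ℕ) → (ℕ → ℕ) → Set
EqualFrom p g h = ∀ j → p ≤ j → g j ≡ h j

SparseFrom : ℕ → (ℕ → ℕ) → Set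
SparseFrom p g = ∀ j → p ≤ j → g j < 2 × ¬ (1 ≤ g j × 1 ≤ g (suc j))

loose-equalFrom : EqualFrom p g h → loose g p ≤ loose h p + c → p ≤′ L → loose g L ≤ loose h L + c
loose-equalFrom eq base ≤′-refl = base
loose-equalFrom {h = h} eq base (≤′-step {L} p≤′L)
  rewrite eq L (≤′⇒≤ p≤′L) | eq (suc L) (m≤n⇒m≤1+n (≤′⇒≤ p≤′L))
  = scan-mono (h L) (h (suc L)) (loose-equalFrom eq base p≤′L)

loose-sparseFrom : EqualFrom p g h → SparseFrom p g → loose g p < loose h p → p ≤′ L → loose g L < loose h L
loose-sparseFrom eq sparse base ≤′-refl = base
loose-sparseFrom {p} {g} {h} eq sparse base (≤′-step {L} p≤′L) = begin-strict
  scan (g L) (g (suc L)) (loose g L)  ≡⟨ scan-sparse _ _ _ small noPair ⟩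
  g L + loose g L                     <⟨ +-monoʳ-< (g L) (loose-sparseFrom eq sparse base p≤′L) ⟩
  g L + loose h L                     ≡⟨ sym (scan-sparse _ _ _ small noPair) ⟩
  scan (g L) (g (suc L)) (loose h L)  ≡⟨ cong₂ (λ x y → scan x y (loose h L)) (eq L p≤L) (eq (suc L) p≤1+L) ⟩
  scan (h L) (h (suc L)) (loose h L)  ∎
  where
  open ≤-Reasoning
  p≤L = ≤′⇒≤ p≤′L
  p≤1+L = m≤n⇒m≤1+n p≤L
  small = proj₁ (sparse L p≤L)
  noPair = proj₂ (sparse L p≤L)

sumTo-+ : ∀ g h L → sumTo (λ j → g j + h j) L ≡ sumTo g L + sumTo h L
sumTo-+ g h zero    = refl
sumTo-+ g h (suc L) = trans (cong (_+ (g L + h L)) (sumTo-+ g h L)) (interchange (sumTo g L) (sumTo h L) (g L) (h L))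

sumTo-balance : ∀ L → (∀ j → h j + u j ≡ g j + v j) → sumTo h L + sumTo u L ≡ sumTo g L + sumTo v L
sumTo-balance zero    eq = refl
sumTo-balance {h} {u} {g} {v} (suc L) eq = begin
  sumTo h L + h L + (sumTo u L + u L)      ≡⟨ interchange (sumTo h L) (h L) (sumTo u L) (u L) ⟩
  sumTo h L + sumTo u L + (h L + u L)      ≡⟨ cong₂ _+_ (sumTo-balance L eq) (eq L) ⟩
  sumTo g L + sumTo v L + (g L + v L)      ≡⟨ interchange (sumTo g L) (sumTo v L) (g L) (v L) ⟩
  sumTo g L + g L + (sumTo v L + v L)      ∎
  where open ≡-Reasoning

sumTo-cong : ∀ L → (∀ j → g j ≡ h j) → sumTo g L ≡ sumTo h L
sumTo-cong zero    eq = refl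
sumTo-cong (suc L) eq = cong₂ _+_ (sumTo-cong L eq) (eq L)

sumTo-suc : ∀ g L → sumTo g (suc L) ≡ g 0 + sumTo (λ j → g (suc j)) L
sumTo-suc g zero    = +-comm 0 (g 0)
sumTo-suc g (suc L) = trans (cong (_+ g (suc L)) (sumTo-suc g L)) (+-assoc (g 0) _ _)

≤-sumTo : ∀ g {p L} → p < L → g p ≤ sumTo g L
≤-sumTo g {p} {suc L} (s≤s p≤L) with p ≟ L
... | yes refl = m≤n+m (g p) (sumTo g p)
... | no p≢L   = ≤-trans (≤-sumTo g (≤∧≢⇒< p≤L p≢L)) (m≤m+n (sumTo g L) (g L))

-- δ decides p ≟ j rather than j ≟ p, so that a later `with j ≟ k` does not abstract inside it.
δ : ℕ → ℕ → ℕ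
δ p j with p ≟ j
... | yes _ = 1
... | no _  = 0

δ-same : ∀ p → δ p p ≡ 1
δ-same p with p ≟ p
... | yes _   = refl
... | no p≢p = contradiction refl p≢p

δ-other : ∀ {p j} → j ≢ p → δ p j ≡ 0
δ-other {p} {j} j≢p with p ≟ j
... | yes p≡j = contradiction (sym p≡j) j≢p
... | no _    = refl

sumTo-δ-≤ : ∀ {p L} → L ≤ p → sumTo (δ p) L ≡ 0
sumTo-δ-≤ {p} {zero}  _   = refl
sumTo-δ-≤ {p} {suc L} L<p = cong₂ _+_ (sumTo-δ-≤ (<⇒≤ L<p)) (δ-other (<⇒≢ L<p))

sumTo-δ : ∀ {p L} → p < L → sumTo (δ p) L ≡ 1
sumTo-δ {p} {suc L} (s≤s p≤L) with L ≟ p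
... | yes refl = cong₂ _+_ (sumTo-δ-≤ {p} ≤-refl) (δ-same p)
... | no L≢p   = cong₂ _+_ (sumTo-δ (≤∧≢⇒< p≤L (≢-sym L≢p))) (δ-other L≢p)

-- Moves on ℕ-indexed configurations

CombineStepℕ : (ℕ → ℕ) → ℕ → (ℕ → ℕ) → Set
CombineStepℕ g k h =
  (g k ≡ suc (h k)) × (g (1 + k) ≡ suc (h (1 + k))) × (h (2 + k) ≡ suc (g (2 + k))) ×
  (∀ j → j ≢ k → j ≢ 1 + k → j ≢ 2 + k → h j ≡ g j)

-- The split is at 2 + k, so that its left target k needs no subtraction.
SplitStepℕ : (ℕ → ℕ) → ℕ → (ℕ → ℕ) → Set
SplitStepℕ g k h =
  (g (2 + k) ≡ 2 + h (2 + k)) × (h (3 + k) ≡ suc (g (3 + k))) × (h k ≡ suc (g k)) ×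
  (∀ j → j ≢ 2 + k → j ≢ 3 + k → j ≢ k → h j ≡ g j)

module _ {g h : ℕ → ℕ} {k : ℕ} where

  combine-balance : CombineStepℕ g k h → ∀ j → h j + (δ k j + δ (1 + k) j) ≡ g j + δ (2 + k) j
  combine-balance (at-k , at-1+k , at-2+k , elsewhere) j with j ≟ k
  ... | yes refl
    rewrite δ-same j | δ-other {1 + j} (m≢1+n+m j {0}) | δ-other {2 + j} (m≢1+n+m j {1}) | at-k
    = trans (+-comm (h j) 1) (sym (+-identityʳ _))
  ... | no j≢k with j ≟ 1 + k
  ...   | yes refl
    rewrite δ-same j | δ-other {k} (1+n≢n {k}) | δ-other {2 + k} (m≢1+n+m j {0}) | at-1+k
    = trans (+-comm (h j) 1) (sym (+-identityʳ _))
  ...   | no j≢1+k with j ≟ 2 + k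
  ...     | yes refl
    rewrite δ-same j | δ-other {k} (≢-sym (m≢1+n+m k {1})) | δ-other {1 + k} (1+n≢n {1 + k}) | at-2+k
    = trans (+-identityʳ _) (+-comm 1 (g j))
  ...     | no j≢2+k
    rewrite δ-other j≢k | δ-other j≢1+k | δ-other j≢2+k | elsewhere j j≢k j≢1+k j≢2+k
    = refl

  combine-sum : CombineStepℕ g k h → ∀ {L} → 3 + k ≤ L → sumTo h L + 1 ≡ sumTo g L
  combine-sum move {L} 3+k≤L = +-cancelʳ-≡ 1 _ _ (begin
    sumTo h L + 1 + 1                                 ≡⟨ +-assoc (sumTo h L) 1 1 ⟩
    sumTo h L + 2                                     ≡⟨ cong (_+_ (sumTo h L)) (sym leaving) ⟩
    sumTo h L + sumTo (λ j → δ k j + δ (1 + k) j) L  ≡⟨ sumTo-balance L (combine-balance move) ⟩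
    sumTo g L + sumTo (δ (2 + k)) L                   ≡⟨ cong (_+_ (sumTo g L)) (sumTo-δ 3+k≤L) ⟩
    sumTo g L + 1                                     ∎)
    where
    open ≡-Reasoning
    leaving : sumTo (λ j → δ k j + δ (1 + k) j) L ≡ 2
    leaving = trans (sumTo-+ (δ k) (δ (1 + k)) L)
                    (cong₂ _+_ (sumTo-δ (≤-trans (m≤n+m (1 + k) 2) 3+k≤L))
                               (sumTo-δ (≤-trans (m≤n+m (2 + k) 1) 3+k≤L)))

  combine-equalFrom : CombineStepℕ g k h → EqualFrom (3 + k) g h
  combine-equalFrom (_ , _ , _ , elsewhere) j 3+k≤j =
    sym (elsewhere j (>⇒≢ (≤-trans (m≤n+m (1 + k) 2) 3+k≤j))
                     (>⇒≢ (≤-trans (m≤n+m (2 + k) 1) 3+k≤j))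
                     (>⇒≢ 3+k≤j))

  combine-loose : CombineStepℕ g k h → ∀ {L} → 3 + k ≤ L → loose g L ≤ loose h L + 2
  combine-loose move@(at-k , at-1+k , _) 3+k≤L =
    loose-equalFrom (combine-equalFrom move) (≤-trans base (m≤n+m 2 _)) (≤⇒≤′ 3+k≤L)
    where
    pairCleared : loose g (1 + k) ≡ 0
    pairCleared = trans (cong₂ (λ x y → scan x y (loose g k)) at-k at-1+k) (scan-pair (h k) (h (1 + k)) _)
    base : loose g (3 + k) ≤ 2
    base = ≤-trans (scan-≤-suc (g (2 + k)) (g (3 + k)) _)
                   (s≤s (≤-trans (scan-≤-suc (g (1 + k)) (g (2 + k)) _) (s≤s (≤-reflexive pairCleared))))

  split-balance : SplitStepℕ g k h → ∀ j → h j + (δ (2 + k) j + δ (2 + k) j) ≡ g j + (δ (3 + k) j + δ k j)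
  split-balance (at-2+k , at-3+k , at-k , elsewhere) j with j ≟ 2 + k
  ... | yes refl
    rewrite δ-same j | δ-other {1 + j} (m≢1+n+m j {0}) | δ-other {k} (≢-sym (m≢1+n+m k {1})) | at-2+k
    = trans (+-comm (h j) 2) (sym (+-identityʳ _))
  ... | no j≢2+k with j ≟ 3 + k
  ...   | yes refl
    rewrite δ-same j | δ-other {2 + k} (1+n≢n {2 + k}) | δ-other {k} (≢-sym (m≢1+n+m k {2})) | at-3+k
    = trans (+-identityʳ _) (+-comm 1 (g j))
  ...   | no j≢3+k with j ≟ k
  ...     | yes refl
    rewrite δ-same j | δ-other {2 + j} (m≢1+n+m j {1}) | δ-other {3 + j} (m≢1+n+m j {2}) | at-k
    = trans (+-identityʳ _) (+-comm 1 (g j))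
  ...     | no j≢k
    rewrite δ-other j≢2+k | δ-other j≢3+k | δ-other j≢k | elsewhere j j≢2+k j≢3+k j≢k
    = refl

  split-sum : SplitStepℕ g k h → ∀ {L} → 4 + k ≤ L → sumTo h L ≡ sumTo g L
  split-sum move {L} 4+k≤L = +-cancelʳ-≡ 2 _ _ (begin
    sumTo h L + 2                                          ≡⟨ cong (_+_ (sumTo h L)) (sym leaving) ⟩
    sumTo h L + sumTo (λ j → δ (2 + k) j + δ (2 + k) j) L ≡⟨ sumTo-balance L (split-balance move) ⟩
    sumTo g L + sumTo (λ j → δ (3 + k) j + δ k j) L       ≡⟨ cong (_+_ (sumTo g L)) arriving ⟩
    sumTo g L + 2                                          ∎)
    where
    open ≡-Reasoning
    2+k<L = ≤-trans (m≤n+m (3 + k) 1) 4+k≤L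
    leaving : sumTo (λ j → δ (2 + k) j + δ (2 + k) j) L ≡ 2
    leaving = trans (sumTo-+ (δ (2 + k)) (δ (2 + k)) L) (cong₂ _+_ (sumTo-δ 2+k<L) (sumTo-δ 2+k<L))
    arriving : sumTo (λ j → δ (3 + k) j + δ k j) L ≡ 2
    arriving = trans (sumTo-+ (δ (3 + k)) (δ k) L)
                     (cong₂ _+_ (sumTo-δ 4+k≤L) (sumTo-δ (≤-trans (m≤n+m (1 + k) 3) 4+k≤L)))

  split-equalFrom : SplitStepℕ g k h → EqualFrom (4 + k) g h
  split-equalFrom (_ , _ , _ , elsewhere) j 4+k≤j =
    sym (elsewhere j (>⇒≢ (≤-trans (m≤n+m (3 + k) 1) 4+k≤j))
                     (>⇒≢ 4+k≤j)
                     (>⇒≢ (≤-trans (m≤n+m (1 + k) 3) 4+k≤j)))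

  split-clears : SplitStepℕ g k h → g (3 + k) ≡ 0 → loose g (4 + k) ≡ 0
  split-clears (at-2+k , _) empty =
    cong₂ (λ x y → scan x (g (4 + k)) (scan y (g (3 + k)) (loose g (2 + k)))) empty at-2+k

  split-loose : SplitStepℕ g k h → g (3 + k) ≡ 0 → ∀ {L} → 4 + k ≤ L → loose g L ≤ loose h L
  split-loose move empty {L} 4+k≤L = subst (loose g L ≤_) (+-identityʳ (loose h L))
    (loose-equalFrom (split-equalFrom move) (≤-trans (≤-reflexive (split-clears move empty)) z≤n)
                     (≤⇒≤′ 4+k≤L))

  split-loose-sparse : SplitStepℕ g k h → g (3 + k) ≡ 0 → g (4 + k) ≡ 0 → SparseFrom (4 + k) g →
                       ∀ {L} → 4 + k ≤ L → loose g L < loose h L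
  split-loose-sparse move@(_ , at-3+k , _) empty empty′ sparse 4+k≤L =
    loose-sparseFrom (split-equalFrom move) sparse base (≤⇒≤′ 4+k≤L)
    where
    lone : loose h (4 + k) ≡ suc (loose h (3 + k))
    lone = cong₂ (λ x y → scan x y (loose h (3 + k)))
                 (trans at-3+k (cong suc empty))
                 (trans (sym (split-equalFrom move (4 + k) ≤-refl)) empty′)
    base : loose g (4 + k) < loose h (4 + k)
    base rewrite split-clears move empty | lone = s≤s z≤n

-- States seen through a window

window : (ℤ → ℕ) → ℕ → ℕ → ℕ
window a W k = a (+ k ℤ.- + W)

shift : ∀ d k W → + (d + k) ℤ.- + W ≡ (+ k ℤ.- + W) ℤ.+ + d
shift d k W = trans (cong (ℤ._- + W) (ℤP.pos-+ d k)) (rearrange (+ d) (+ k) (+ W))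
  where
  rearrange : ∀ e x w → (e ℤ.+ x) ℤ.- w ≡ (x ℤ.- w) ℤ.+ e
  rearrange = solve-∀

shift-back : ∀ k W → + k ℤ.- + W ≡ (+ (2 + k) ℤ.- + W) ℤ.- + 2
shift-back k W = trans (undo (+ k ℤ.- + W)) (cong (ℤ._- + 2) (sym (shift 2 k W)))
  where
  undo : ∀ x → x ≡ (x ℤ.+ + 2) ℤ.- + 2
  undo = solve-∀

window-injective : ∀ W {k k′} → + k ℤ.- + W ≡ + k′ ℤ.- + W → k ≡ k′
window-injective W {k} {k′} eq = ℤP.+-injective (∙-cancelʳ (ℤ.- + W) (+ k) (+ k′) eq)

+-≢ : ∀ i {c d} → c ≢ d → i ℤ.+ c ≢ i ℤ.+ d
+-≢ i {c} {d} c≢d = c≢d ∘ ∙-cancelˡ i c d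

module _ {a b : ℤ → ℕ} (W k : ℕ) where

  combineStep-window : CombineStep a (+ k ℤ.- + W) b → CombineStepℕ (window a W) k (window b W)
  combineStep-window (at-i , at-i+1 , at-i+2 , elsewhere) =
    at-i ,
    subst (λ x → a x ≡ suc (b x)) (sym (shift 1 k W)) at-i+1 ,
    subst (λ x → b x ≡ suc (a x)) (sym (shift 2 k W)) at-i+2 ,
    λ j j≢k j≢1+k j≢2+k → elsewhere (+ j ℤ.- + W)
      (j≢k ∘ window-injective W)
      (j≢1+k ∘ window-injective W ∘ (λ e → trans e (sym (shift 1 k W))))
      (j≢2+k ∘ window-injective W ∘ (λ e → trans e (sym (shift 2 k W))))

  splitStep-window : SplitStep a (+ (2 + k) ℤ.- + W) b → SplitStepℕ (window a W) k (window b W)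
  splitStep-window (at-i , at-i+1 , at-i-2 , elsewhere) =
    at-i ,
    subst (λ x → b x ≡ suc (a x)) (sym (shift 1 (2 + k) W)) at-i+1 ,
    subst (λ x → b x ≡ suc (a x)) (sym (shift-back k W)) at-i-2 ,
    λ j j≢2+k j≢3+k j≢k → elsewhere (+ j ℤ.- + W)
      (j≢2+k ∘ window-injective W)
      (j≢3+k ∘ window-injective W ∘ (λ e → trans e (sym (shift 1 (2 + k) W))))
      (j≢k ∘ window-injective W ∘ (λ e → trans e (sym (shift-back k W))))

≡suc⇒≥1 : ∀ {x y} → x ≡ suc y → 1 ≤ x
≡suc⇒≥1 refl = s≤s z≤n

≢-self : ∀ i {c} → c ≢ + 0 → i ℤ.+ c ≢ i
≢-self i c≢0 eq = +-≢ i c≢0 (trans eq (sym (ℤP.+-identityʳ i)))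

module _ {a b : ℤ → ℕ} {i j : ℤ} where

  combine-support : CombineStep a i b → 1 ≤ b j → j ≢ i ℤ.+ + 2 → 1 ≤ a j
  combine-support (at-i , at-i+1 , _ , elsewhere) occ j≢i+2 with j ℤ.≟ i | j ℤ.≟ i ℤ.+ + 1
  ... | yes refl | _        = ≡suc⇒≥1 at-i
  ... | no _     | yes refl = ≡suc⇒≥1 at-i+1
  ... | no j≢i   | no j≢i+1 = subst (1 ≤_) (elsewhere j j≢i j≢i+1 j≢i+2) occ

  split-support : SplitStep a i b → 1 ≤ b j → j ≢ i ℤ.+ + 1 → j ≢ i ℤ.- + 2 → 1 ≤ a j
  split-support (at-i , _ , _ , elsewhere) occ j≢i+1 j≢i-2 with j ℤ.≟ i
  ... | yes refl = ≡suc⇒≥1 at-i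
  ... | no j≢i   = subst (1 ≤_) (elsewhere j j≢i j≢i+1 j≢i-2) occ

-- The Quick Termination strategy

module _ {a : ℤ → ℕ} where

  noCombine⇒right-empty : NoneOf Cat1 a → ∀ {i} → 1 ≤ a i → a (i ℤ.+ + 1) ≡ 0
  noCombine⇒right-empty noC {i} occ = n<1⇒n≡0 (≰⇒> (λ occ′ → noC i (occ , occ′)))

  noCombine⇒left-empty : NoneOf Cat1 a → ∀ {i} → 1 ≤ a i → a (i ℤ.- + 1) ≡ 0
  noCombine⇒left-empty noC {i} occ =
    n<1⇒n≡0 (≰⇒> (λ occ′ → noC (i ℤ.- + 1) (occ′ , subst (λ x → 1 ≤ a x) (sym (back i)) occ)))
    where
    back : ∀ i → (i ℤ.- + 1) ℤ.+ + 1 ≡ i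
    back = solve-∀

  noCat2⇒≡2 : NoneOf Cat2 a → ∀ {i} → 2 ≤ a i → a i ≡ 2
  noCat2⇒≡2 noC2 {i} 2≤ai = ≤-antisym (s≤s⁻¹ (≰⇒> (noC2 i))) 2≤ai

  cat4-unreachable : NoneOf Cat1 a → NoneOf Cat2 a → NoneOf Cat3 a → ∀ {i} → ¬ Cat4 a i
  cat4-unreachable noC noC2 noC3 {i} (ai≡2 , left , _ , _ , 2≤ai-2) =
    noC3 (i ℤ.- + 2)
      ( noCat2⇒≡2 noC2 2≤ai-2
      , noCombine⇒left-empty noC (≤-trans (s≤s z≤n) 2≤ai-2)
      , subst (λ x → a x ≡ 0) (sym (minus2plus1 i)) left
      , inj₂ (subst (λ x → 0 < a x) (sym (minus2plus2 i)) (subst (0 <_) (sym ai≡2) (s≤s z≤n))) )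
    where
    minus2plus1 : ∀ i → (i ℤ.- + 2) ℤ.+ + 1 ≡ i ℤ.- + 1
    minus2plus1 = solve-∀
    minus2plus2 : ∀ i → (i ℤ.- + 2) ℤ.+ + 2 ≡ i
    minus2plus2 = solve-∀

  cat5-shape : NoneOf Cat1 a → NoneOf Cat2 a → NoneOf Cat3 a → ∀ {i} → Cat5 a i →
               a (i ℤ.+ + 1) ≡ 0 × a (i ℤ.+ + 2) ≡ 0
  cat5-shape noC noC2 noC3 {i} (2≤ai , _) = right , n<1⇒n≡0 (≰⇒> (λ occ → noC3 i
      (noCat2⇒≡2 noC2 2≤ai , noCombine⇒left-empty noC occ-i , right , inj₂ occ)))
    where
    occ-i = ≤-trans (s≤s z≤n) 2≤ai
    right = noCombine⇒right-empty noC occ-i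

module _ {a b : ℤ → ℕ} {i : ℤ} where

  cat2-then-combine : Cat2 a i → SplitStep a i b → Cat1 b i
  cat2-then-combine 3≤ai (at-i , at-i+1 , _) =
    s≤s⁻¹ (s≤s⁻¹ (subst (3 ≤_) at-i 3≤ai)) , ≡suc⇒≥1 at-i+1

  cat3-then-combine : Cat3 a i → SplitStep a i b → ∃ (Cat1 b)
  cat3-then-combine (_ , _ , _ , inj₂ occ) (_ , at-i+1 , _ , elsewhere) =
    i ℤ.+ + 1 , ≡suc⇒≥1 at-i+1 ,
    subst (λ x → 1 ≤ b x) (sym (plus1plus1 i))
      (subst (1 ≤_) (sym (elsewhere (i ℤ.+ + 2) (≢-self i (λ ())) (+-≢ i (λ ())) (+-≢ i (λ ())))) occ)
    where
    plus1plus1 : ∀ i → (i ℤ.+ + 1) ℤ.+ + 1 ≡ i ℤ.+ + 2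
    plus1plus1 = solve-∀
  cat3-then-combine (_ , _ , _ , inj₁ occ) (_ , _ , at-i-2 , elsewhere) =
    i ℤ.- + 3 ,
    subst (1 ≤_) (sym (elsewhere (i ℤ.- + 3) (≢-self i (λ ())) (+-≢ i (λ ())) (+-≢ i (λ ())))) occ ,
    subst (λ x → 1 ≤ b x) (sym (minus3plus1 i)) (≡suc⇒≥1 at-i-2)
    where
    minus3plus1 : ∀ i → (i ℤ.- + 3) ℤ.+ + 1 ≡ i ℤ.- + 2
    minus3plus1 = solve-∀

combine-forced : ∀ {b c j} → Cat1 b j → QTStep b c → ∃[ i ] (Cat1 b i × CombineStep b i c)
combine-forced _   (qt1 i available move)  = i , available , move
combine-forced cat (qt2 _ noC _ _)         = ⊥-elim (noC _ cat)
combine-forced cat (qt3 _ noC _ _ _)       = ⊥-elim (noC _ cat)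
combine-forced cat (qt4 _ noC _ _ _ _)     = ⊥-elim (noC _ cat)
combine-forced cat (qt5 _ noC _ _ _ _ _)   = ⊥-elim (noC _ cat)

-- The potential argument

bound-two-moves : ∀ {n r r′ t t′} → n + r′ ≤ 4 * t′ → t′ + 1 ≡ t → r ≤ r′ + 2 →
                  2 + n + r ≤ 4 * t
bound-two-moves {n} {r} {r′} {t} {t′} invariant mass≡ loose≤ = begin
  2 + n + r         ≤⟨ +-monoʳ-≤ (2 + n) loose≤ ⟩
  2 + n + (r′ + 2)  ≡⟨ rearrange n r′ ⟩
  n + r′ + 4        ≤⟨ +-monoˡ-≤ 4 invariant ⟩
  4 * t′ + 4        ≡⟨ sym (*-distribˡ-+ 4 t′ 1) ⟩
  4 * (t′ + 1)      ≡⟨ cong (4 *_) mass≡ ⟩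
  4 * t             ∎
  where
  open ≤-Reasoning
  rearrange : ∀ n r′ → 2 + n + (r′ + 2) ≡ n + r′ + 4
  rearrange = ℕSolver.solve-∀

bound-one-move : ∀ {n r r′ t} → n + r′ ≤ 4 * t → r < r′ → 1 + n + r ≤ 4 * t
bound-one-move {n} {r} invariant gain =
  ≤-trans (≤-reflexive (sym (+-suc n r))) (≤-trans (+-monoʳ-≤ n gain) invariant)

bound-last-move : ∀ {r t} → r ≤ t → 1 ≤ t → 1 + r ≤ 4 * t
bound-last-move {r} {t} r≤t 1≤t = ≤-trans (+-mono-≤ 1≤t r≤t) (+-monoʳ-≤ t (m≤m+n t _))

bound-done : ∀ {r t} → r ≤ t → 0 + r ≤ 4 * t
bound-done {t = t} r≤t = ≤-trans r≤t (m≤m+n t _)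

margin : ℕ → ℕ
margin zero    = 0
margin (suc n) = 2 + margin n

module Windowed (W L : ℕ) where

  Within : ℕ → (ℤ → ℕ) → Set
  Within m a = ∀ j → 1 ≤ a j → ∃[ k ] (j ≡ + k ℤ.- + W × m ≤ k × k + m < L)

  mass : (ℤ → ℕ) → ℕ
  mass a = sumTo (window a W) L

  looseness : (ℤ → ℕ) → ℕ
  looseness a = loose (window a W) L

  private variable
    d k m : ℕ
    a b : ℤ → ℕ
    i : ℤ

  moved-in-window : d ≤ 2 → k + (2 + m) < L → d + k + m < L
  moved-in-window {d} {k} {m} d≤2 k+2+m<L =
    ≤-trans (s≤s (≤-trans (+-monoˡ-≤ m (+-monoˡ-≤ k d≤2)) (≤-reflexive (sym k+[2+m]≡2+k+m)))) k+2+m<L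
    where
    k+[2+m]≡2+k+m : k + (2 + m) ≡ 2 + k + m
    k+[2+m]≡2+k+m = trans (+-suc k (suc m)) (cong suc (+-suc k m))

  room-right : k + (2 + m) < L → 3 + k ≤ L
  room-right {k} {m} k+2+m<L = ≤-trans (s≤s (m≤m+n (2 + k) m)) (moved-in-window ≤-refl k+2+m<L)

  within-weaken : Within (2 + m) a → Within m a
  within-weaken {m} w j occ with w j occ
  ... | k , at , lo , hi = k , at , ≤-trans (m≤n+m m 2) lo , ≤-trans (s≤s (+-monoʳ-≤ k (m≤n+m m 2))) hi

  within-combine : Within (2 + m) a → 1 ≤ a i → CombineStep a i b → Within m b
  within-combine {m} {i = i} w occ-i move j occ with j ℤ.≟ i ℤ.+ + 2
  ... | no j≢i+2 = within-weaken w j (combine-support move occ j≢i+2)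
  ... | yes refl with w i occ-i
  ...   | k , refl , lo , hi =
    2 + k , sym (shift 2 k W) , ≤-trans (m≤n+m m 2) (≤-trans lo (m≤n+m k 2)) , moved-in-window ≤-refl hi

  within-split : Within (2 + m) a → 2 ≤ a i → SplitStep a i b → Within m b
  within-split {m} {i = i} w 2≤ai move j occ with w i (≤-trans (s≤s z≤n) 2≤ai)
  ... | suc (suc k₀) , refl , s≤s (s≤s lo) , hi with j ℤ.≟ i ℤ.+ + 1 | j ℤ.≟ i ℤ.- + 2
  ...   | yes refl | _        =
    3 + k₀ , sym (shift 1 (2 + k₀) W) , ≤-trans lo (m≤n+m k₀ 3) ,
    moved-in-window {k = 2 + k₀} (s≤s z≤n) hi
  ...   | no _     | yes refl =
    k₀ , sym (shift-back k₀ W) , lo , ≤-trans (s≤s (+-mono-≤ (m≤n+m k₀ 2) (m≤n+m m 2))) hi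
  ...   | no j≢i+1 | no j≢i-2 = within-weaken w j (split-support move occ j≢i+1 j≢i-2)

  combine-window : Within (2 + m) a → Cat1 a i → CombineStep a i b →
                   mass b + 1 ≡ mass a × looseness a ≤ looseness b + 2
  combine-window w (occ , _) move with w _ occ
  ... | k , refl , _ , hi = combine-sum moveℕ room , combine-loose moveℕ room
    where
    moveℕ = combineStep-window W k move
    room = room-right hi

  split-window : Within (2 + m) a → 2 ≤ a i → a (i ℤ.+ + 1) ≡ 0 → SplitStep a i b →
                 mass b ≡ mass a × looseness a ≤ looseness b
  split-window {a = a} w 2≤ai right move with w _ (≤-trans (s≤s z≤n) 2≤ai)
  ... | suc (suc k₀) , refl , s≤s (s≤s _) , hi = split-sum moveℕ room , split-loose moveℕ right′ room
    where
    moveℕ = splitStep-window W k₀ move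
    room = ≤-trans (n≤1+n _) (room-right hi)
    right′ = subst (λ x → a x ≡ 0) (sym (shift 1 (2 + k₀) W)) right

  split-window-sparse : Within (2 + m) a → 2 ≤ a i → a (i ℤ.+ + 1) ≡ 0 → a (i ℤ.+ + 2) ≡ 0 →
                        (∀ j → i ℤ.< j → a j < 2) → NoneOf Cat1 a → SplitStep a i b →
                        looseness a < looseness b
  split-window-sparse {a = a} w 2≤ai right right₂ small noC move with w _ (≤-trans (s≤s z≤n) 2≤ai)
  ... | suc (suc k₀) , refl , s≤s (s≤s _) , hi =
    split-loose-sparse (splitStep-window W k₀ move) right′ right₂′ sparse
                       (≤-trans (n≤1+n _) (room-right hi))
    where
    right′ = subst (λ x → a x ≡ 0) (sym (shift 1 (2 + k₀) W)) right
    right₂′ = subst (λ x → a x ≡ 0) (sym (shift 2 (2 + k₀) W)) right₂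
    sparse : SparseFrom (4 + k₀) (window a W)
    sparse j 4+k₀≤j =
      small (+ j ℤ.- + W) (ℤP.+-monoˡ-< (ℤ.- + W) (+<+ (≤-trans (n≤1+n _) 4+k₀≤j))) ,
      λ (occ , occ′) → noC (+ j ℤ.- + W) (occ , subst (λ x → 1 ≤ a x) (shift 1 j W) occ′)

  occupied≤mass : Within m a → ∀ i → 1 ≤ a i → a i ≤ mass a
  occupied≤mass {m} {a} w i occ with w i occ
  ... | k , refl , _ , hi = ≤-sumTo (window a W) (≤-trans (s≤s (m≤m+n k m)) hi)

  split-then-combine : Within (2 + (2 + m)) a → 2 ≤ a i → a (i ℤ.+ + 1) ≡ 0 → SplitStep a i b →
                       ∀ {j c} → Cat1 b j → QTStep b c →
                       Within m c × mass c + 1 ≡ mass a × looseness a ≤ looseness c + 2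
  split-then-combine w 2≤ai right split cat next with combine-forced cat next
  ... | _ , cat′ , combine =
    within-combine w′ (proj₁ cat′) combine ,
    trans (proj₁ after) (proj₁ before) ,
    ≤-trans (proj₂ before) (proj₂ after)
    where
    w′ = within-split w 2≤ai split
    before = split-window w 2≤ai right split
    after = combine-window w′ cat′ combine

  qtPlay-bound : ∀ n → Within (margin n) a → QTPlay a n → n + looseness a ≤ 4 * mass a
  qtPlay-bound zero w done = bound-done (loose≤sumTo _ L)
  qtPlay-bound {a} (suc n) w (step (qt1 _ cat combine) play) =
    ≤-trans (+-monoˡ-≤ (looseness a) (n≤1+n (suc n)))
      (bound-two-moves (qtPlay-bound n (within-combine w (proj₁ cat) combine) play) (proj₁ after) (proj₂ after))
    where after = combine-window w cat combine
  qtPlay-bound 1 w (step (qt2 i _ 3≤ai _) done) =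
    bound-last-move (loose≤sumTo _ L) (≤-trans 1≤ai (occupied≤mass w i 1≤ai))
    where 1≤ai = ≤-trans (s≤s z≤n) 3≤ai
  qtPlay-bound (suc (suc n)) w (step (qt2 _ noC 3≤ai split) (step next play)) =
    let w′ , mass≡ , loose≤ = split-then-combine w 2≤ai right split (cat2-then-combine 3≤ai split) next
    in bound-two-moves (qtPlay-bound n w′ play) mass≡ loose≤
    where
    2≤ai = ≤-trans (n≤1+n 2) 3≤ai
    right = noCombine⇒right-empty noC (≤-trans (s≤s z≤n) 3≤ai)
  qtPlay-bound 1 w (step (qt3 i _ _ (ai≡2 , _) _) done) =
    bound-last-move (loose≤sumTo _ L) (≤-trans 1≤ai (occupied≤mass w i 1≤ai))
    where 1≤ai = subst (1 ≤_) (sym ai≡2) (s≤s z≤n)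
  qtPlay-bound (suc (suc n)) w (step (qt3 _ _ _ cat3@(ai≡2 , _ , right , _) split) (step next play)) =
    let w′ , mass≡ , loose≤ = split-then-combine w (≤-reflexive (sym ai≡2)) right split
                                (proj₂ (cat3-then-combine cat3 split)) next
    in bound-two-moves (qtPlay-bound n w′ play) mass≡ loose≤
  qtPlay-bound (suc n) w (step (qt4 _ noC noC2 noC3 cat4 _) _) = ⊥-elim (cat4-unreachable noC noC2 noC3 cat4)
  qtPlay-bound {a} (suc n) w (step {b = b} (qt5 _ noC noC2 noC3 _ cat5@(2≤ai , small) split) play) =
    bound-one-move {t = mass a}
      (subst (λ t → n + looseness b ≤ 4 * t) (proj₁ (split-window w 2≤ai right split))
             (qtPlay-bound n (within-split w 2≤ai split) play))
      (split-window-sparse w 2≤ai right right₂ small noC split)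
    where
    right = proj₁ (cat5-shape noC noC2 noC3 cat5)
    right₂ = proj₂ (cat5-shape noC noC2 noC3 cat5)

-- The initial state

sumFrom≡sumTo-window : ∀ a N L → sumFrom a N L ≡ sumTo (window a N) L
sumFrom≡sumTo-window a N zero    = refl
sumFrom≡sumTo-window a N (suc L) = cong (_+ a (+ L ℤ.- + N)) (sumFrom≡sumTo-window a N L)

sumTo-window-widen : ∀ a M → a -[1+ M ] ≡ 0 → a (+ suc M) ≡ 0 →
                     sumTo (window a (suc M)) (suc (suc M + suc M)) ≡ sumTo (window a M) (suc (M + M))
sumTo-window-widen a M left right = begin
  sumTo (window a (suc M)) (suc (suc M + suc M))
    ≡⟨ sumTo-suc (window a (suc M)) _ ⟩
  a -[1+ M ] + sumTo (λ k → window a (suc M) (suc k)) (suc (M + suc M))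
    ≡⟨ cong₂ _+_ left (sumTo-cong _ (λ k → cong a (recentre k))) ⟩
  sumTo (window a M) (suc (M + suc M))
    ≡⟨ cong (λ l → sumTo (window a M) (suc l)) (+-suc M M) ⟩
  sumTo (window a M) (suc (M + M)) + a (+ suc (M + M) ℤ.- + M)
    ≡⟨ cong (_+_ (sumTo (window a M) (suc (M + M)))) (trans (cong a top) right) ⟩
  sumTo (window a M) (suc (M + M)) + 0
    ≡⟨ +-identityʳ _ ⟩
  sumTo (window a M) (suc (M + M))
    ∎
  where
  open ≡-Reasoning
  recentre : ∀ k → + suc k ℤ.- + suc M ≡ + k ℤ.- + M
  recentre k = trans (cong₂ ℤ._-_ (ℤP.pos-+ 1 k) (ℤP.pos-+ 1 M)) (cancel (+ k) (+ M))
    where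
    cancel : ∀ x w → (+ 1 ℤ.+ x) ℤ.- (+ 1 ℤ.+ w) ≡ x ℤ.- w
    cancel = solve-∀
  top : + suc (M + M) ℤ.- + M ≡ + suc M
  top = trans (cong (ℤ._- + M) (trans (ℤP.pos-+ 1 (M + M)) (cong (λ x → + 1 ℤ.+ x) (ℤP.pos-+ M M))))
              (trans (cancel (+ M)) (sym (ℤP.pos-+ 1 M)))
    where
    cancel : ∀ w → (+ 1 ℤ.+ (w ℤ.+ w)) ℤ.- w ≡ + 1 ℤ.+ w
    cancel = solve-∀

chips-window-size : ∀ S t → let W = bound S + t in sumTo (window (chips S) W) (suc (W + W)) ≡ size S
chips-window-size S zero = begin
  sumTo (window (chips S) (N + 0)) (suc ((N + 0) + (N + 0)))
    ≡⟨ cong (λ W → sumTo (window (chips S) W) (suc (W + W))) (+-identityʳ N) ⟩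
  sumTo (window (chips S) N) (suc (N + N))
    ≡⟨ cong (λ l → sumTo (window (chips S) N) (suc (N + l))) (sym (+-identityʳ N)) ⟩
  sumTo (window (chips S) N) (suc (2 * N))
    ≡⟨ sym (sumFrom≡sumTo-window (chips S) N (suc (2 * N))) ⟩
  size S
    ∎
  where
  open ≡-Reasoning
  N = bound S
chips-window-size S (suc t) rewrite +-suc (bound S) t =
  trans (sumTo-window-widen (chips S) (bound S + t)
          (support S -[1+ bound S + t ] (s≤s (m≤m+n (bound S) t)))
          (support S (+ suc (bound S + t)) (s≤s (m≤m+n (bound S) t))))
        (chips-window-size S t)

chips-within : ∀ S m → let W = bound S + m in Windowed.Within W (suc (W + W)) m (chips S)
chips-within S m j occ =
  centre j (≮⇒≥ (λ N<∣j∣ → contradiction (subst (1 ≤_) (support S j N<∣j∣) occ) λ ()))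
  where
  N = bound S
  W = N + m
  centre : ∀ j → ℤ.∣ j ∣ ≤ N → ∃[ k ] (j ≡ + k ℤ.- + W × m ≤ k × k + m < suc (W + W))
  centre (+ t) t≤N =
    t + W ,
    trans (undo (+ t) (+ W)) (cong (ℤ._- + W) (sym (ℤP.pos-+ t W))) ,
    ≤-trans (m≤n+m m N) (m≤n+m W t) ,
    s≤s (≤-trans (≤-reflexive (regroup t W m)) (+-monoʳ-≤ W (+-monoˡ-≤ m t≤N)))
    where
    undo : ∀ x w → x ≡ (x ℤ.+ w) ℤ.- w
    undo = solve-∀
    regroup : ∀ t w m → t + w + m ≡ w + (t + m)
    regroup = ℕSolver.solve-∀
  centre -[1+ t ] 1+t≤N =
    rest + m ,
    trans (undo (+ suc t) (+ rest) (+ m))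
      (sym (cong₂ ℤ._-_ (ℤP.pos-+ rest m)
                       (trans (cong (λ l → + (l + m)) (sym (m+[n∸m]≡n 1+t≤N)))
                              (trans (ℤP.pos-+ (suc t + rest) m) (cong (ℤ._+ + m) (ℤP.pos-+ (suc t) rest)))))) ,
    m≤n+m m rest ,
    s≤s (+-mono-≤ (+-monoˡ-≤ m (m∸n≤m N (suc t))) (m≤n+m m N))
    where
    rest = N ∸ suc t
    undo : ∀ x r m → ℤ.- x ≡ (r ℤ.+ m) ℤ.- ((x ℤ.+ r) ℤ.+ m)
    undo = solve-∀

mainTheorem7 : (S : State) (n : ℕ) → QTPlay (chips S) n → n ≤ 4 * size S
mainTheorem7 S n play = begin
  n                        ≤⟨ m≤m+n n _ ⟩
  n + looseness (chips S)  ≤⟨ qtPlay-bound n (chips-within S (margin n)) play ⟩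
  4 * mass (chips S)       ≡⟨ cong (4 *_) (chips-window-size S (margin n)) ⟩
  4 * size S               ∎
  where
  open ≤-Reasoning
  W = bound S + margin n
  open Windowed W (suc (W + W))
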